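{- Let $G={\rm C}_4\rtimes{\rm C}_4=\langle g_1,g_2\mid g_1^4=g_2^4=e,\ g_2g_1=g_1^3g_2\rangle=\{g_1^sg_2^t\mid 0\le s,t\le 3\}$. Then, as polynomials, $$D_G(z_0,z_1,\ldots,z_{15})=D_{4\times 2}(z_0+z_8,z_1+z_9,\ldots,z_7+z_{15})\,F(z_0-z_8,z_1-z_9,\ldots,z_7-z_{15})^2.$$
   Context: For $g=g_1^sg_2^t\in G$ ($0\le s,t\le 3$) write the variable $z_g$ as $z_j$ with $j=t+4s$, and set $D_G(z_0,\ldots,z_{15})=\det(z_{gh^{ -1}})_{g,h\in G}$. For $(\bar r,\bar s)\in{\rm C}_4\times{\rm C}_2$ ($r\in\{0,1,2,3\}$, $s\in\{0,1\}$) write the variable $y_{(\bar r,\bar s)}$ as $y_j$ with $j=r+4s$, and set $D_{4\times2}(y_0,\ldots,y_7)=\det(y_{gh^{ -1}})_{g,h\in{\rm C}_4\times{\rm C}_2}$. For $k\in\{0,1\}$ let $f_k(x,y,z,w)=x^2+y^2+(-1)^kz^2+(-1)^kw^2$, and define $F(w_0,\ldots,w_7)=f_0(w_0-w_2,w_4-w_6,w_1-w_3,w_5-w_7)\,f_1(w_0+w_2,w_4+w_6,w_1+w_3,w_5+w_7)$. -}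

module Defs where

open import Level using (Level)
open import Data.Nat as ℕ using (ℕ; _/_; _%_; _^_)
open import Data.Nat.DivMod using (_mod_)
open import Data.Fin as Fin using (Fin; zero; suc; toℕ; punchIn; inject+; raise)
open import Data.Product using (_×_; _,_)
open import Algebra.Bundles using (CommutativeRing)
open import Data.Fin using (#_)

-- The group G = C4 ⋊ C4 = ⟨g1, g2 | g1^4 = g2^4 = e, g2 g1 = g1^3 g2⟩,
-- element g1^s g2^t represented by the pair (s , t), 0 ≤ s,t ≤ 3.
-- Since g2^t g1^s' = g1^(3^t s') g2^t :
--   (g1^s g2^t)(g1^s' g2^t') = g1^(s + 3^t s') g2^(t + t')
--   (g1^s g2^t)⁻¹ = g1^(3^(t+1) s) g2^(3 t)       (exponents mod 4)
mulG : ℕ × ℕ → ℕ × ℕ → ℕ × ℕ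
mulG (s , t) (s' , t') = ((s ℕ.+ 3 ^ t ℕ.* s') % 4 , (t ℕ.+ t') % 4)

invG : ℕ × ℕ → ℕ × ℕ
invG (s , t) = ((3 ^ (ℕ.suc t) ℕ.* s) % 4 , (3 ℕ.* t) % 4)

-- index j = t + 4 s  of  g1^s g2^t
elemG : Fin 16 → ℕ × ℕ
elemG j = (toℕ j / 4 , toℕ j % 4)

idxG : ℕ × ℕ → Fin 16
idxG (s , t) = ((t % 4) ℕ.+ 4 ℕ.* (s % 4)) mod 16

-- The group C4 × C2, element (r̄ , s̄) with index j = r + 4 s.
mulC : ℕ × ℕ → ℕ × ℕ → ℕ × ℕ
mulC (r , s) (r' , s') = ((r ℕ.+ r') % 4 , (s ℕ.+ s') % 2)

invC : ℕ × ℕ → ℕ × ℕ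
invC (r , s) = ((3 ℕ.* r) % 4 , s % 2)

elemC : Fin 8 → ℕ × ℕ
elemC j = (toℕ j % 4 , toℕ j / 4)

idxC : ℕ × ℕ → Fin 8
idxC (r , s) = ((r % 4) ℕ.+ 4 ℕ.* (s % 2)) mod 8

module _ {c ℓ : Level} (R : CommutativeRing c ℓ) where
  open CommutativeRing R using (Carrier; _+_; _*_; _-_; 0#; 1#)

  altSum : ∀ {m} → (Fin m → Carrier) → Carrier
  altSum {ℕ.zero}  f = 0#
  altSum {ℕ.suc m} f = f zero - altSum (λ j → f (suc j))

  det : ∀ n → (Fin n → Fin n → Carrier) → Carrier
  det ℕ.zero    M = 1#
  det (ℕ.suc n) M =
    altSum (λ j → M zero j * det n (λ i k → M (suc i) (punchIn j k)))

  DG : (Fin 16 → Carrier) → Carrier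
  DG z = det 16 (λ g h → z (idxG (mulG (elemG g) (invG (elemG h)))))

  D42 : (Fin 8 → Carrier) → Carrier
  D42 y = det 8 (λ g h → y (idxC (mulC (elemC g) (invC (elemC h)))))

  f0 : Carrier → Carrier → Carrier → Carrier → Carrier
  f0 x y z w = x * x + y * y + z * z + w * w

  f1 : Carrier → Carrier → Carrier → Carrier → Carrier
  f1 x y z w = x * x + y * y - z * z - w * w

  F : (Fin 8 → Carrier) → Carrier
  F w = f0 (w (# 0) - w (# 2)) (w (# 4) - w (# 6)) (w (# 1) - w (# 3)) (w (# 5) - w (# 7))
      * f1 (w (# 0) + w (# 2)) (w (# 4) + w (# 6)) (w (# 1) + w (# 3)) (w (# 5) + w (# 7))

{-# OPTIONS --safe #-}
-- g₁² is central of order 2. Listing G as the coset s ∈ {0, 1} followed by the coset s ∈ {2, 3}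
-- of ⟨g₁²⟩ makes the group matrix block symmetric, [[A, B], [B, A]], and such a determinant is
-- det (A + B) · det (A − B). The matrix A + B is the group matrix of G/⟨g₁²⟩ ≅ C₄ × C₂ in the
-- variables z_j + z_{j+8}. In A − B the central element g₂² plays the same role once the rows and
-- columns are reordered, which leaves two 4 × 4 determinants in the differences z_j − z_{j+8}.
-- The ring solver evaluates them to the squares of F's factors f₁(…) and f₀(…).
module Submission where

open import Defs
open import Level using (Level)
open import Data.Fin using (Fin; _↑ˡ_; _↑ʳ_)
open import Algebra.Bundles using (CommutativeRing)

open import Algebra.Solver.Ring.AlmostCommutativeRing using (_-Raw-AlmostCommutative⟶_; fromCommutativeRing)
open import Data.Bool using (true; false; if_then_else_)
open import Data.Empty using (⊥-elim)
open import Data.Fin as Fin using (zero; suc; punchIn; punchOut; inject₁; toℕ; splitAt; #_)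
import Data.Fin.Properties as Finₚ
open import Data.Fin.Permutation.Components using (transpose)
open import Data.Integer as ℤ using (ℤ; +_; -[1+_]; _⊖_; _◃_; sign; ∣_∣)
import Data.Integer.Properties as ℤₚ
open import Data.Maybe using (Maybe; just; nothing)
open import Data.Nat as ℕ using (ℕ; zero; suc)
import Data.Nat.Properties as ℕₚ
open import Data.Product using (_×_; _,_; proj₁; proj₂; ∃)
import Data.Product.Properties as Productₚ
open import Data.Sign as Sign using (Sign)
open import Data.Sum using (_⊎_; inj₁; inj₂)
open import Data.Vec using (Vec; tabulate)
open import Data.Vec.Properties using (lookup∘tabulate)
open import Data.Vec.Functional using (_++_)
open import Data.Vec.Functional.Properties using (lookup-++ˡ; lookup-++ʳ)
open import Function using (_∘_)
open import Function.Definitions using (Injective)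
open import Relation.Binary.Definitions using (DecidableEquality; Tri)
open import Relation.Binary.PropositionalEquality as ≡ using (_≡_; _≢_)
open import Relation.Nullary using (Dec; yes; no; does)
open import Relation.Nullary.Decidable using (from-yes; dec-true; dec-false; _×-dec_; _⊎-dec_)

-- The ring solver of the library needs coefficients with decidable equality; ℤ maps into every ring.
module IntegerCoefficients {c ℓ : Level} (R : CommutativeRing c ℓ) where
  open CommutativeRing R
  open import Algebra.Properties.Ring ring
    using (-0#≈0#; -‿involutive; -‿+-comm; -‿distribˡ-*; -‿distribʳ-*)
  open import Algebra.Properties.Semiring.Mult semiring using (×-homo-+; ×1-homo-*)
    renaming (_×_ to _×ₙ_)
  open import Relation.Binary.Reasoning.Setoid setoid

  fromℤ : ℤ → Carrier
  fromℤ (+ n)    = n ×ₙ 1#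
  fromℤ -[1+ n ] = - (suc n ×ₙ 1#)

  fromℤ-⊖ : ∀ m n → fromℤ (m ⊖ n) ≈ m ×ₙ 1# - n ×ₙ 1#
  fromℤ-⊖ zero    zero    = sym (trans (+-identityˡ _) -0#≈0#)
  fromℤ-⊖ zero    (suc n) = sym (+-identityˡ _)
  fromℤ-⊖ (suc m) zero    = sym (trans (+-congˡ -0#≈0#) (+-identityʳ _))
  fromℤ-⊖ (suc m) (suc n) = begin
    fromℤ (suc m ⊖ suc n)               ≡⟨ ≡.cong fromℤ (ℤₚ.[1+m]⊖[1+n]≡m⊖n m n) ⟩
    fromℤ (m ⊖ n)                       ≈⟨ fromℤ-⊖ m n ⟩
    m ×ₙ 1# - n ×ₙ 1#                   ≈⟨ +-congʳ (+-identityˡ _) ⟨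
    (0# + m ×ₙ 1#) - n ×ₙ 1#            ≈⟨ +-congʳ (+-congʳ (-‿inverseʳ 1#)) ⟨
    ((1# - 1#) + m ×ₙ 1#) - n ×ₙ 1#     ≈⟨ +-congʳ (+-assoc _ _ _) ⟩
    (1# + (- 1# + m ×ₙ 1#)) - n ×ₙ 1#   ≈⟨ +-congʳ (+-congˡ (+-comm _ _)) ⟩
    (1# + (m ×ₙ 1# - 1#)) - n ×ₙ 1#     ≈⟨ +-congʳ (+-assoc _ _ _) ⟨
    ((1# + m ×ₙ 1#) - 1#) - n ×ₙ 1#     ≈⟨ +-assoc _ _ _ ⟩
    (1# + m ×ₙ 1#) + (- 1# - n ×ₙ 1#)   ≈⟨ +-congˡ (-‿+-comm _ _) ⟩
    (1# + m ×ₙ 1#) - (1# + n ×ₙ 1#)     ∎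

  signed : Sign → Carrier → Carrier
  signed Sign.+ x = x
  signed Sign.- x = - x

  signed-cong : ∀ s {x y} → x ≈ y → signed s x ≈ signed s y
  signed-cong Sign.+ x≈y = x≈y
  signed-cong Sign.- x≈y = -‿cong x≈y

  signed-* : ∀ s t x y → signed (s Sign.* t) (x * y) ≈ signed s x * signed t y
  signed-* Sign.+ Sign.+ x y = refl
  signed-* Sign.+ Sign.- x y = -‿distribʳ-* x y
  signed-* Sign.- Sign.+ x y = -‿distribˡ-* x y
  signed-* Sign.- Sign.- x y = begin
    x * y          ≈⟨ -‿involutive _ ⟨
    - - (x * y)    ≈⟨ -‿cong (-‿distribˡ-* x y) ⟩
    - (- x * y)    ≈⟨ -‿distribʳ-* _ _ ⟩
    - x * - y      ∎

  fromℤ-◃ : ∀ s n → fromℤ (s ◃ n) ≈ signed s (n ×ₙ 1#)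
  fromℤ-◃ Sign.+ zero    = refl
  fromℤ-◃ Sign.- zero    = sym -0#≈0#
  fromℤ-◃ Sign.+ (suc n) = refl
  fromℤ-◃ Sign.- (suc n) = refl

  fromℤ-sign-abs : ∀ i → fromℤ i ≈ signed (sign i) (∣ i ∣ ×ₙ 1#)
  fromℤ-sign-abs (+ n)    = refl
  fromℤ-sign-abs -[1+ n ] = refl

  fromℤ-+ : ∀ i j → fromℤ (i ℤ.+ j) ≈ fromℤ i + fromℤ j
  fromℤ-+ (+ m)    (+ n)    = ×-homo-+ 1# m n
  fromℤ-+ (+ m)    -[1+ n ] = fromℤ-⊖ m (suc n)
  fromℤ-+ -[1+ m ] (+ n)    = trans (fromℤ-⊖ n (suc m)) (+-comm _ _)
  fromℤ-+ -[1+ m ] -[1+ n ] = begin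
    - (suc (suc (m ℕ.+ n)) ×ₙ 1#)  ≡⟨ ≡.cong (λ k → - (suc k ×ₙ 1#)) (ℕₚ.+-suc m n) ⟨
    - ((suc m ℕ.+ suc n) ×ₙ 1#)    ≈⟨ -‿cong (×-homo-+ 1# (suc m) (suc n)) ⟩
    - (suc m ×ₙ 1# + suc n ×ₙ 1#)  ≈⟨ -‿+-comm _ _ ⟨
    - (suc m ×ₙ 1#) - suc n ×ₙ 1#  ∎

  fromℤ-* : ∀ i j → fromℤ (i ℤ.* j) ≈ fromℤ i * fromℤ j
  fromℤ-* i j = begin
    fromℤ ((sign i Sign.* sign j) ◃ (∣ i ∣ ℕ.* ∣ j ∣))
      ≈⟨ fromℤ-◃ (sign i Sign.* sign j) (∣ i ∣ ℕ.* ∣ j ∣) ⟩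
    signed (sign i Sign.* sign j) ((∣ i ∣ ℕ.* ∣ j ∣) ×ₙ 1#)
      ≈⟨ signed-cong (sign i Sign.* sign j) (×1-homo-* ∣ i ∣ ∣ j ∣) ⟩
    signed (sign i Sign.* sign j) ((∣ i ∣ ×ₙ 1#) * (∣ j ∣ ×ₙ 1#))
      ≈⟨ signed-* (sign i) (sign j) _ _ ⟩
    signed (sign i) (∣ i ∣ ×ₙ 1#) * signed (sign j) (∣ j ∣ ×ₙ 1#)
      ≈⟨ *-cong (fromℤ-sign-abs i) (fromℤ-sign-abs j) ⟨
    fromℤ i * fromℤ j ∎

  fromℤ-neg : ∀ i → fromℤ (ℤ.- i) ≈ - fromℤ i
  fromℤ-neg (+ zero)  = sym -0#≈0#
  fromℤ-neg (+ suc n) = refl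
  fromℤ-neg -[1+ n ]  = sym (-‿involutive _)

  fromℤ-homomorphism : ℤ.+-*-rawRing -Raw-AlmostCommutative⟶ fromCommutativeRing R
  fromℤ-homomorphism = record
    { ⟦_⟧    = fromℤ
    ; +-homo = fromℤ-+
    ; *-homo = fromℤ-*
    ; -‿homo = fromℤ-neg
    ; 0-homo = refl
    ; 1-homo = +-identityʳ 1#
    }

  fromℤ-≟ : ∀ i j → Maybe (fromℤ i ≈ fromℤ j)
  fromℤ-≟ i j with i ℤ.≟ j
  ... | yes ≡.refl = just refl
  ... | no _     = nothing

  open import Algebra.Solver.Ring ℤ.+-*-rawRing (fromCommutativeRing R) fromℤ-homomorphism fromℤ-≟ public

punchIn-inject₁-self : ∀ {n} (c : Fin n) → punchIn (inject₁ c) c ≡ suc c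
punchIn-inject₁-self zero    = ≡.refl
punchIn-inject₁-self (suc c) = ≡.cong suc (punchIn-inject₁-self c)

punchIn-suc-self : ∀ {n} (c : Fin n) → punchIn (suc c) c ≡ inject₁ c
punchIn-suc-self zero    = ≡.refl
punchIn-suc-self (suc c) = ≡.cong suc (punchIn-suc-self c)

punchIn-inject₁≡punchIn-suc : ∀ {n} {c k : Fin n} → k ≢ c → punchIn (inject₁ c) k ≡ punchIn (suc c) k
punchIn-inject₁≡punchIn-suc {c = zero}  {zero}  k≢c = ⊥-elim (k≢c ≡.refl)
punchIn-inject₁≡punchIn-suc {c = zero}  {suc k} k≢c = ≡.refl
punchIn-inject₁≡punchIn-suc {c = suc c} {zero}  k≢c = ≡.refl
punchIn-inject₁≡punchIn-suc {c = suc c} {suc k} k≢c =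
  ≡.cong suc (punchIn-inject₁≡punchIn-suc (k≢c ∘ ≡.cong suc))

punchIn-adjacent : ∀ {m} (l : Fin (suc (suc m))) (c : Fin (suc m)) → l ≢ inject₁ c → l ≢ suc c →
  ∃ λ d → punchIn l (inject₁ d) ≡ inject₁ c × punchIn l (suc d) ≡ suc c
punchIn-adjacent zero                zero    l≢c _     = ⊥-elim (l≢c ≡.refl)
punchIn-adjacent zero                (suc c) _   _     = c , ≡.refl , ≡.refl
punchIn-adjacent (suc zero)          zero    _   l≢c+1 = ⊥-elim (l≢c+1 ≡.refl)
punchIn-adjacent {suc m} (suc (suc l)) zero  _   _     = zero , ≡.refl , ≡.refl
punchIn-adjacent {suc m} (suc l)     (suc c) l≢c l≢c+1
  with d , eq₁ , eq₂ ← punchIn-adjacent l c (l≢c ∘ ≡.cong suc) (l≢c+1 ∘ ≡.cong suc)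
  = suc d , ≡.cong suc eq₁ , ≡.cong suc eq₂

transpose-left : ∀ {n} (a b : Fin n) → transpose a b a ≡ b
transpose-left a b rewrite dec-true (a Finₚ.≟ a) ≡.refl = ≡.refl

transpose-right : ∀ {n} (a b : Fin n) → transpose a b b ≡ a
transpose-right a b with b Finₚ.≟ a
... | yes b≡a = b≡a
... | no _ rewrite dec-true (b Finₚ.≟ b) ≡.refl = ≡.refl

transpose-other : ∀ {n} {a b k : Fin n} → k ≢ a → k ≢ b → transpose a b k ≡ k
transpose-other {a = a} {b} {k} k≢a k≢b
  rewrite dec-false (k Finₚ.≟ a) k≢a | dec-false (k Finₚ.≟ b) k≢b = ≡.refl

punchIn-↑ˡ : ∀ {n m} (j : Fin (suc n)) (k : Fin n) → punchIn (j ↑ˡ m) (k ↑ˡ m) ≡ punchIn j k ↑ˡ m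
punchIn-↑ˡ zero    k       = ≡.refl
punchIn-↑ˡ (suc j) zero    = ≡.refl
punchIn-↑ˡ (suc j) (suc k) = ≡.cong suc (punchIn-↑ˡ j k)

punchIn-↑ʳ : ∀ {n m} (j : Fin (suc n)) (k : Fin m) → punchIn (j ↑ˡ m) (n ↑ʳ k) ≡ suc n ↑ʳ k
punchIn-↑ʳ         zero    k = ≡.refl
punchIn-↑ʳ {suc n} (suc j) k = ≡.cong suc (punchIn-↑ʳ j k)

↑ˡ≢↑ʳ : ∀ {m n} (i : Fin m) (j : Fin n) → i ↑ˡ n ≢ m ↑ʳ j
↑ˡ≢↑ʳ {m} {n} i j eq
  with () ← ≡.trans (≡.sym (Finₚ.splitAt-↑ˡ m i n)) (≡.trans (≡.cong (splitAt m) eq) (Finₚ.splitAt-↑ʳ m n j))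

↑ˡ-or-↑ʳ : ∀ m {n} (l : Fin (m ℕ.+ n)) → (∃ λ h → h ↑ˡ n ≡ l) ⊎ (∃ λ h → m ↑ʳ h ≡ l)
↑ˡ-or-↑ʳ m l with splitAt m l in eq
... | inj₁ h = inj₁ (h , Finₚ.splitAt⁻¹-↑ˡ eq)
... | inj₂ h = inj₂ (h , Finₚ.splitAt⁻¹-↑ʳ eq)

module _ {a} {X : Set a} {n : ℕ} (M : Fin (n ℕ.+ n) → Fin (n ℕ.+ n) → X) where

  upperLeft upperRight lowerLeft lowerRight : Fin n → Fin n → X
  upperLeft  i k = M (i ↑ˡ n) (k ↑ˡ n)
  upperRight i k = M (i ↑ˡ n) (n ↑ʳ k)
  lowerLeft  i k = M (n ↑ʳ i) (k ↑ˡ n)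
  lowerRight i k = M (n ↑ʳ i) (n ↑ʳ k)

BlockSymmetric : ∀ {a} {X : Set a} n → (Fin (n ℕ.+ n) → Fin (n ℕ.+ n) → X) → Set a
BlockSymmetric n M = ∀ (i k : Fin n) → lowerLeft M i k ≡ upperRight M i k × lowerRight M i k ≡ upperLeft M i k

blockSymmetric? : ∀ {a} {X : Set a} → DecidableEquality X → ∀ n (M : Fin (n ℕ.+ n) → Fin (n ℕ.+ n) → X) →
  Dec (BlockSymmetric n M)
blockSymmetric? _≟_ n M = Finₚ.all? λ i → Finₚ.all? λ k →
  (lowerLeft M i k ≟ upperRight M i k) ×-dec (lowerRight M i k ≟ upperLeft M i k)

BlockSymmetric-map : ∀ {a b} {X : Set a} {Y : Set b} n (f : X → Y) {M : Fin (n ℕ.+ n) → Fin (n ℕ.+ n) → X} →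
  BlockSymmetric n M → BlockSymmetric n (λ i k → f (M i k))
BlockSymmetric-map n f sym-M i k = ≡.cong f (proj₁ (sym-M i k)) , ≡.cong f (proj₂ (sym-M i k))

conjugate : ∀ {a} {X : Set a} {n} → (Fin n → Fin n) → (Fin n → Fin n → X) → Fin n → Fin n → X
conjugate τ M i k = M (τ i) (τ k)

module Determinant {c ℓ : Level} (R : CommutativeRing c ℓ) where
  open CommutativeRing R hiding (zero)
  open import Algebra.Properties.Ring ring using (-0#≈0#; -‿involutive; -1*x≈-x; +-inverseʳ-unique)
  open IntegerCoefficients R using (solve; _:=_; _:+_; _:*_; _:-_; con)
  open import Relation.Binary.Reasoning.Setoid setoid

  Matrix : ℕ → Set c
  Matrix n = Fin n → Fin n → Carrier

  altSum-cong : ∀ {m} {f g : Fin m → Carrier} → (∀ j → f j ≈ g j) → altSum R f ≈ altSum R g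
  altSum-cong {zero}  f≈g = refl
  altSum-cong {suc m} f≈g = +-cong (f≈g zero) (-‿cong (altSum-cong (f≈g ∘ suc)))

  altSum-zero : ∀ {m} {f : Fin m → Carrier} → (∀ j → f j ≈ 0#) → altSum R f ≈ 0#
  altSum-zero {zero}  f≈0 = refl
  altSum-zero {suc m} f≈0 =
    trans (+-cong (f≈0 zero) (-‿cong (altSum-zero (f≈0 ∘ suc)))) (-‿inverseʳ 0#)

  altSum-*ˡ : ∀ {m} a (f : Fin m → Carrier) → altSum R (λ j → a * f j) ≈ a * altSum R f
  altSum-*ˡ {zero}  a f = sym (zeroʳ a)
  altSum-*ˡ {suc m} a f = begin
    a * f zero - altSum R (λ j → a * f (suc j))  ≈⟨ +-congˡ (-‿cong (altSum-*ˡ a (f ∘ suc))) ⟩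
    a * f zero - a * altSum R (f ∘ suc)          ≈⟨ solve 3 (λ a x y → a :* x :- a :* y := a :* (x :- y)) refl a (f zero) _ ⟩
    a * (f zero - altSum R (f ∘ suc))            ∎

  altSum-*ʳ : ∀ {m} a (f : Fin m → Carrier) → altSum R (λ j → f j * a) ≈ altSum R f * a
  altSum-*ʳ a f = trans (altSum-cong (λ j → *-comm (f j) a)) (trans (altSum-*ˡ a f) (*-comm a _))

  altSum-linear : ∀ {m} a b (f g : Fin m → Carrier) →
    altSum R (λ j → a * f j + b * g j) ≈ a * altSum R f + b * altSum R g
  altSum-linear {zero}  a b f g = sym (trans (+-cong (zeroʳ a) (zeroʳ b)) (+-identityʳ 0#))
  altSum-linear {suc m} a b f g = begin
    (a * f zero + b * g zero) - altSum R (λ j → a * f (suc j) + b * g (suc j))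
      ≈⟨ +-congˡ (-‿cong (altSum-linear a b (f ∘ suc) (g ∘ suc))) ⟩
    (a * f zero + b * g zero) - (a * altSum R (f ∘ suc) + b * altSum R (g ∘ suc))
      ≈⟨ solve 6 (λ a b x y u v → (a :* x :+ b :* y) :- (a :* u :+ b :* v) := a :* (x :- u) :+ b :* (y :- v))
               refl a b (f zero) (g zero) _ _ ⟩
    a * (f zero - altSum R (f ∘ suc)) + b * (g zero - altSum R (g ∘ suc)) ∎

  altSum-difference : ∀ {m} (f g : Fin m → Carrier) → altSum R (λ j → f j - g j) ≈ altSum R f - altSum R g
  altSum-difference {zero}  f g = sym (trans (+-congˡ -0#≈0#) (+-identityʳ 0#))
  altSum-difference {suc m} f g = begin
    (f zero - g zero) - altSum R (λ j → f (suc j) - g (suc j))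
      ≈⟨ +-congˡ (-‿cong (altSum-difference (f ∘ suc) (g ∘ suc))) ⟩
    (f zero - g zero) - (altSum R (f ∘ suc) - altSum R (g ∘ suc))
      ≈⟨ solve 4 (λ x y u v → (x :- y) :- (u :- v) := (x :- u) :- (y :- v)) refl (f zero) (g zero) _ _ ⟩
    (f zero - altSum R (f ∘ suc)) - (g zero - altSum R (g ∘ suc)) ∎

  altSum-comm : ∀ {m k} (f : Fin m → Fin k → Carrier) →
    altSum R (λ j → altSum R (λ i → f i j)) ≈ altSum R (λ i → altSum R (f i))
  altSum-comm {m} {zero} f = sym (altSum-zero {m} (λ _ → refl))
  altSum-comm {m} {suc k} f = begin
    altSum R (λ i → f i zero) - altSum R (λ j → altSum R (λ i → f i (suc j)))
      ≈⟨ +-congˡ (-‿cong (altSum-comm (λ i j → f i (suc j)))) ⟩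
    altSum R (λ i → f i zero) - altSum R (λ i → altSum R (f i ∘ suc))
      ≈⟨ altSum-difference (λ i → f i zero) (λ i → altSum R (f i ∘ suc)) ⟨
    altSum R (λ i → f i zero - altSum R (f i ∘ suc)) ∎

  altSum-adjacent : ∀ {n} (c : Fin n) (f : Fin (suc n) → Carrier) →
    (∀ l → l ≢ inject₁ c → l ≢ suc c → f l ≈ 0#) → f (inject₁ c) ≈ f (suc c) → altSum R f ≈ 0#
  altSum-adjacent {suc n} zero f others f₀≈f₁ = begin
    f zero - (f (suc zero) - altSum R (λ j → f (suc (suc j))))
      ≈⟨ +-congˡ (-‿cong (+-cong (sym f₀≈f₁) (-‿cong (altSum-zero (λ j → others (suc (suc j)) (λ ()) (λ ())))))) ⟩
    f zero - (f zero - 0#)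
      ≈⟨ solve 1 (λ x → x :- (x :- con (+ 0)) := con (+ 0)) refl (f zero) ⟩
    0# ∎
  altSum-adjacent {suc n} (suc c) f others f₀≈f₁ = begin
    f zero - altSum R (f ∘ suc)
      ≈⟨ +-cong (others zero (λ ()) (λ ())) (-‿cong (altSum-adjacent c (f ∘ suc)
           (λ l l≢c l≢c+1 → others (suc l) (l≢c ∘ Finₚ.suc-injective) (l≢c+1 ∘ Finₚ.suc-injective)) f₀≈f₁)) ⟩
    0# - 0# ≈⟨ -‿inverseʳ 0# ⟩
    0# ∎

  altSum-↑ˡ : ∀ a {b} (f : Fin (a ℕ.+ b) → Carrier) → (∀ k → f (a ↑ʳ k) ≈ 0#) →
    altSum R f ≈ altSum R (λ j → f (j ↑ˡ b))
  altSum-↑ˡ zero    f f≈0 = altSum-zero f≈0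
  altSum-↑ˡ (suc a) f f≈0 = +-congˡ (-‿cong (altSum-↑ˡ a (f ∘ suc) f≈0))

  altSum-*-comm : ∀ {m k} (a : Fin k → Carrier) (b : Fin m → Carrier) (X : Fin m → Fin k → Carrier) →
    altSum R (λ j → a j * altSum R (λ i → b i * X i j)) ≈ altSum R (λ i → b i * altSum R (λ j → a j * X i j))
  altSum-*-comm a b X = begin
    altSum R (λ j → a j * altSum R (λ i → b i * X i j))
      ≈⟨ altSum-cong (λ j → altSum-*ˡ (a j) (λ i → b i * X i j)) ⟨
    altSum R (λ j → altSum R (λ i → a j * (b i * X i j)))
      ≈⟨ altSum-cong (λ j → altSum-cong (λ i → x∙yz≈y∙xz (a j) (b i) (X i j))) ⟩
    altSum R (λ j → altSum R (λ i → b i * (a j * X i j)))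
      ≈⟨ altSum-comm (λ i j → b i * (a j * X i j)) ⟩
    altSum R (λ i → altSum R (λ j → b i * (a j * X i j)))
      ≈⟨ altSum-cong (λ i → altSum-*ˡ (b i) (λ j → a j * X i j)) ⟩
    altSum R (λ i → b i * altSum R (λ j → a j * X i j)) ∎
    where open import Algebra.Properties.CommutativeSemigroup *-commutativeSemigroup using (x∙yz≈y∙xz)

  minor : ∀ {n} → Fin (suc n) → Matrix (suc n) → Matrix n
  minor j M i k = M (suc i) (punchIn j k)

  det-cong : ∀ n {M N : Matrix n} → (∀ i k → M i k ≈ N i k) → det R n M ≈ det R n N
  det-cong zero    M≈N = refl
  det-cong (suc n) M≈N =
    altSum-cong (λ j → *-cong (M≈N zero j) (det-cong n (λ i k → M≈N (suc i) (punchIn j k))))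

  det-expand-column₀ : ∀ n (M : Matrix (suc n)) →
    det R (suc n) M ≈ altSum R (λ i → M i zero * det R n (λ a b → M (punchIn i a) (suc b)))
  det-expand-column₀ zero    M = refl
  det-expand-column₀ (suc n) M = +-congˡ (-‿cong (begin
    altSum R (λ j → M zero (suc j) * det R (suc n) (minor (suc j) M))
      ≈⟨ altSum-cong (λ j → *-congˡ {M zero (suc j)} (det-expand-column₀ n (minor (suc j) M))) ⟩
    altSum R (λ j → M zero (suc j) * altSum R (λ i → M (suc i) zero * X i j))
      ≈⟨ altSum-*-comm (λ j → M zero (suc j)) (λ i → M (suc i) zero) X ⟩
    altSum R (λ i → M (suc i) zero * altSum R (λ j → M zero (suc j) * X i j)) ∎))
    where
    X : Fin (suc n) → Fin (suc n) → Carrier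
    X i j = det R n (λ a b → M (suc (punchIn i a)) (suc (punchIn j b)))

  det-transpose : ∀ n (M : Matrix n) → det R n (λ i k → M k i) ≈ det R n M
  det-transpose zero    M = refl
  det-transpose (suc n) M = trans
    (altSum-cong (λ j → *-congˡ {M j zero} (det-transpose n (λ a b → M (punchIn j a) (suc b)))))
    (sym (det-expand-column₀ n M))

  det-linear : ∀ n (c : Fin n) a b (M N P : Matrix n) →
    (∀ i k → k ≢ c → P i k ≈ M i k) → (∀ i k → k ≢ c → P i k ≈ N i k) →
    (∀ i → P i c ≈ a * M i c + b * N i c) → det R n P ≈ a * det R n M + b * det R n N
  det-linear (suc n) c a b M N P P≈M P≈N P-c = begin
    altSum R (λ l → P zero l * det R n (minor l P))                  ≈⟨ altSum-cong term ⟩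
    altSum R (λ l → a * (M zero l * det R n (minor l M)) + b * (N zero l * det R n (minor l N)))
      ≈⟨ altSum-linear a b (λ l → M zero l * det R n (minor l M)) (λ l → N zero l * det R n (minor l N)) ⟩
    a * det R (suc n) M + b * det R (suc n) N                        ∎
    where
    term : ∀ l → P zero l * det R n (minor l P) ≈ a * (M zero l * det R n (minor l M)) + b * (N zero l * det R n (minor l N))
    term l with l Finₚ.≟ c
    ... | yes ≡.refl = begin
      P zero l * det R n (minor l P)                              ≈⟨ *-congʳ (P-c zero) ⟩
      (a * M zero l + b * N zero l) * det R n (minor l P)
        ≈⟨ solve 5 (λ a b x y d → (a :* x :+ b :* y) :* d := a :* (x :* d) :+ b :* (y :* d)) refl a b (M zero l) (N zero l) _ ⟩
      a * (M zero l * det R n (minor l P)) + b * (N zero l * det R n (minor l P))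
        ≈⟨ +-cong (*-congˡ (*-congˡ (det-cong n (λ i k → P≈M (suc i) (punchIn l k) (Finₚ.punchInᵢ≢i l k)))))
                  (*-congˡ (*-congˡ (det-cong n (λ i k → P≈N (suc i) (punchIn l k) (Finₚ.punchInᵢ≢i l k))))) ⟩
      a * (M zero l * det R n (minor l M)) + b * (N zero l * det R n (minor l N)) ∎
    ... | no l≢c = begin
      P zero l * det R n (minor l P)                                      ≈⟨ *-congˡ minor-linear ⟩
      P zero l * (a * det R n (minor l M) + b * det R n (minor l N))
        ≈⟨ solve 5 (λ p a b x y → p :* (a :* x :+ b :* y) := a :* (p :* x) :+ b :* (p :* y)) refl (P zero l) a b _ _ ⟩
      a * (P zero l * det R n (minor l M)) + b * (P zero l * det R n (minor l N))
        ≈⟨ +-cong (*-congˡ (*-congʳ (P≈M zero l l≢c))) (*-congˡ (*-congʳ (P≈N zero l l≢c))) ⟩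
      a * (M zero l * det R n (minor l M)) + b * (N zero l * det R n (minor l N)) ∎
      where
      punchIn-≢ : ∀ k → k ≢ punchOut l≢c → punchIn l k ≢ c
      punchIn-≢ k k≢ l≡c = k≢ (≡.trans (≡.sym (Finₚ.punchOut-punchIn l)) (Finₚ.punchOut-cong l l≡c))
      minor-linear : det R n (minor l P) ≈ a * det R n (minor l M) + b * det R n (minor l N)
      minor-linear = det-linear n (punchOut l≢c) a b (minor l M) (minor l N) (minor l P)
        (λ i k k≢ → P≈M (suc i) (punchIn l k) (punchIn-≢ k k≢))
        (λ i k k≢ → P≈N (suc i) (punchIn l k) (punchIn-≢ k k≢))
        (λ i → ≡.subst (λ x → P (suc i) x ≈ a * M (suc i) x + b * N (suc i) x)
                       (≡.sym (Finₚ.punchIn-punchOut l≢c)) (P-c (suc i)))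

  det-additive : ∀ n (c : Fin n) (M N P : Matrix n) →
    (∀ i k → k ≢ c → P i k ≈ M i k) → (∀ i k → k ≢ c → P i k ≈ N i k) →
    (∀ i → P i c ≈ M i c + N i c) → det R n P ≈ det R n M + det R n N
  det-additive n c M N P P≈M P≈N P-c =
    trans (det-linear n c 1# 1# M N P P≈M P≈N (λ i → trans (P-c i) (sym (+-cong (*-identityˡ _) (*-identityˡ _)))))
          (+-cong (*-identityˡ _) (*-identityˡ _))

  det-adjacent-equal-columns : ∀ n (c : Fin n) (M : Matrix (suc n)) →
    (∀ i → M i (inject₁ c) ≈ M i (suc c)) → det R (suc n) M ≈ 0#
  det-adjacent-equal-columns (suc m) c M same =
    altSum-adjacent c (λ l → M zero l * det R (suc m) (minor l M)) others paired
    where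
    others : ∀ l → l ≢ inject₁ c → l ≢ suc c → M zero l * det R (suc m) (minor l M) ≈ 0#
    others l l≢c l≢c+1 with d , eq₁ , eq₂ ← punchIn-adjacent l c l≢c l≢c+1 =
      trans (*-congˡ (det-adjacent-equal-columns m d (minor l M)
              (λ i → ≡.subst₂ (λ x y → M (suc i) x ≈ M (suc i) y) (≡.sym eq₁) (≡.sym eq₂) (same (suc i)))))
            (zeroʳ _)
    minors-equal : ∀ i k → minor (inject₁ c) M i k ≈ minor (suc c) M i k
    minors-equal i k with k Finₚ.≟ c
    ... | yes ≡.refl = ≡.subst₂ (λ x y → M (suc i) x ≈ M (suc i) y)
                         (≡.sym (punchIn-inject₁-self c)) (≡.sym (punchIn-suc-self c)) (sym (same (suc i)))
    ... | no k≢c     = reflexive (≡.cong (M (suc i)) (punchIn-inject₁≡punchIn-suc k≢c))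
    paired : M zero (inject₁ c) * det R (suc m) (minor (inject₁ c) M) ≈ M zero (suc c) * det R (suc m) (minor (suc c) M)
    paired = *-cong (same zero) (det-cong (suc m) minors-equal)

  -- Expand the vanishing determinant of M with both columns a and b replaced by M_a + M_b.
  det-swap-columns-of-alternating : ∀ n (a b : Fin n) → a ≢ b →
    (∀ M → (∀ i → M i a ≈ M i b) → det R n M ≈ 0#) →
    ∀ M → det R n (λ i k → M i (transpose a b k)) ≈ - det R n M
  det-swap-columns-of-alternating n a b a≢b alternating M = +-inverseʳ-unique _ _ (begin
    det R n M + det R n (λ i k → M i (transpose a b k))
      ≈⟨ +-cong (det-cong n N-uv) (det-cong n N-vu) ⟨
    det R n (N u v) + det R n (N v u)
      ≈⟨ +-cong (+-identityˡ _) (+-identityʳ _) ⟨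
    (0# + det R n (N u v)) + (det R n (N v u) + 0#)
      ≈⟨ +-cong (+-congʳ (N-equal u)) (+-congˡ (N-equal v)) ⟨
    (det R n (N u u) + det R n (N u v)) + (det R n (N v u) + det R n (N v v))
      ≈⟨ +-cong (N-additiveʳ u u v) (N-additiveʳ v u v) ⟨
    det R n (N u u+v) + det R n (N v u+v)
      ≈⟨ N-additiveˡ u v u+v ⟨
    det R n (N u+v u+v)
      ≈⟨ N-equal u+v ⟩
    0# ∎)
    where
    N : (u v : Fin n → Carrier) → Matrix n
    N u v i k = if does (k Finₚ.≟ a) then u i else if does (k Finₚ.≟ b) then v i else M i k
    u v u+v : Fin n → Carrier
    u i = M i a
    v i = M i b
    u+v i = u i + v i
    N-a : ∀ u v i → N u v i a ≡ u i
    N-a u v i rewrite dec-true (a Finₚ.≟ a) ≡.refl = ≡.refl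
    N-b : ∀ u v i → N u v i b ≡ v i
    N-b u v i rewrite dec-false (b Finₚ.≟ a) (a≢b ∘ ≡.sym) | dec-true (b Finₚ.≟ b) ≡.refl = ≡.refl
    N-equal : ∀ w → det R n (N w w) ≈ 0#
    N-equal w = alternating (N w w) (λ i → reflexive (≡.trans (N-a w w i) (≡.sym (N-b w w i))))
    N-additiveˡ : ∀ U U′ V → det R n (N (λ i → U i + U′ i) V) ≈ det R n (N U V) + det R n (N U′ V)
    N-additiveˡ U U′ V = det-additive n a (N U V) (N U′ V) _ off off
      (λ i → reflexive (≡.trans (N-a (λ i → U i + U′ i) V i) (≡.sym (≡.cong₂ _+_ (N-a U V i) (N-a U′ V i)))))
      where
      off : ∀ {X Y} i k → k ≢ a → N X V i k ≈ N Y V i k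
      off i k k≢a rewrite dec-false (k Finₚ.≟ a) k≢a = refl
    N-additiveʳ : ∀ U V V′ → det R n (N U (λ i → V i + V′ i)) ≈ det R n (N U V) + det R n (N U V′)
    N-additiveʳ U V V′ = det-additive n b (N U V) (N U V′) _ off off
      (λ i → reflexive (≡.trans (N-b U (λ i → V i + V′ i) i) (≡.sym (≡.cong₂ _+_ (N-b U V i) (N-b U V′ i)))))
      where
      off : ∀ {X Y} i k → k ≢ b → N U X i k ≈ N U Y i k
      off i k k≢b with does (k Finₚ.≟ a)
      ... | true  = refl
      ... | false rewrite dec-false (k Finₚ.≟ b) k≢b = refl
    N-uv : ∀ i k → N u v i k ≈ M i k
    N-uv i k with k Finₚ.≟ a | k Finₚ.≟ b
    ... | yes ≡.refl | _          = refl
    ... | no _       | yes ≡.refl = refl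
    ... | no _       | no _       = refl
    N-vu : ∀ i k → N v u i k ≈ M i (transpose a b k)
    N-vu i k with k Finₚ.≟ a
    ... | yes ≡.refl = refl
    ... | no _ with k Finₚ.≟ b
    ...   | yes ≡.refl = refl
    ...   | no _       = refl

  -- Swapping the columns c and c + 1 moves the copy of column a one step closer.
  det-equal-columns-apart : ∀ d {n} (a : Fin (suc n)) (c : Fin n) → toℕ a ℕ.+ d ≡ toℕ c →
    ∀ M → (∀ i → M i a ≈ M i (suc c)) → det R (suc n) M ≈ 0#
  det-equal-columns-apart zero a c a+0≡c M same =
    det-adjacent-equal-columns _ c M (λ i → ≡.subst (λ x → M i x ≈ M i (suc c)) a≡c (same i))
    where
    a≡c : a ≡ inject₁ c
    a≡c = Finₚ.toℕ-injective (≡.trans (≡.trans (≡.sym (ℕₚ.+-identityʳ _)) a+0≡c) (≡.sym (Finₚ.toℕ-inject₁ c)))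
  det-equal-columns-apart (suc d) a zero eq M same = ⊥-elim (ℕₚ.m+1+n≢0 (toℕ a) eq)
  det-equal-columns-apart (suc d) {suc n} a c@(suc c₀) eq M same = begin
    det R (suc (suc n)) M            ≈⟨ -‿involutive _ ⟨
    - - det R (suc (suc n)) M        ≈⟨ -‿cong (det-swap-columns-of-alternating _ (inject₁ c) (suc c) c≢c+1
                                                  (λ N → det-adjacent-equal-columns _ c N) M) ⟨
    - det R (suc (suc n)) M′         ≈⟨ -‿cong (det-equal-columns-apart d a (inject₁ c₀) eq′ M′ same′) ⟩
    - 0#                             ≈⟨ -0#≈0# ⟩
    0#                               ∎
    where
    M′ : Matrix (suc (suc n))
    M′ i k = M i (transpose (inject₁ c) (suc c) k)
    a<c : toℕ a ℕ.< toℕ c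
    a<c = ≡.subst (toℕ a ℕ.<_) eq (ℕₚ.m<m+n (toℕ a) ℕ.z<s)
    c≢c+1 : inject₁ c ≢ suc c
    c≢c+1 eq = ℕₚ.<⇒≢ (ℕₚ.n<1+n (toℕ c)) (≡.trans (≡.sym (Finₚ.toℕ-inject₁ c)) (≡.cong toℕ eq))
    same′ : ∀ i → M′ i a ≈ M′ i (suc (inject₁ c₀))
    same′ i = ≡.subst₂ (λ x y → M i x ≈ M i y)
      (≡.sym (transpose-other (λ a≡c → ℕₚ.<⇒≢ a<c (≡.trans (≡.cong toℕ a≡c) (Finₚ.toℕ-inject₁ c)))
                              (λ a≡c+1 → ℕₚ.<⇒≢ (ℕₚ.m<n⇒m<1+n a<c) (≡.cong toℕ a≡c+1))))
      (≡.sym (transpose-left (inject₁ c) (suc c)))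
      (same i)
    eq′ : toℕ a ℕ.+ d ≡ toℕ (inject₁ c₀)
    eq′ = ≡.trans (ℕₚ.suc-injective (≡.trans (≡.sym (ℕₚ.+-suc (toℕ a) d)) eq)) (≡.sym (Finₚ.toℕ-inject₁ c₀))

  det-equal-columns-< : ∀ n (a b : Fin n) → a Fin.< b → ∀ M → (∀ i → M i a ≈ M i b) → det R n M ≈ 0#
  det-equal-columns-< (suc n) a (suc c) a<b = det-equal-columns-apart _ a c (ℕₚ.m+[n∸m]≡n (ℕₚ.≤-pred a<b))

  det-equal-columns : ∀ n (a b : Fin n) → a ≢ b → ∀ M → (∀ i → M i a ≈ M i b) → det R n M ≈ 0#
  det-equal-columns n a b a≢b M same with Finₚ.<-cmp a b
  ... | Tri.tri< a<b _ _ = det-equal-columns-< n a b a<b M same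
  ... | Tri.tri≈ _ a≡b _ = ⊥-elim (a≢b a≡b)
  ... | Tri.tri> _ _ b<a = det-equal-columns-< n b a b<a M (sym ∘ same)

  det-swap-columns : ∀ n (a b : Fin n) → a ≢ b → ∀ M → det R n (λ i k → M i (transpose a b k)) ≈ - det R n M
  det-swap-columns n a b a≢b = det-swap-columns-of-alternating n a b a≢b (det-equal-columns n a b a≢b)

  det-conjugate-transpose : ∀ n (a b : Fin n) → a ≢ b → ∀ M → det R n (conjugate (transpose a b) M) ≈ det R n M
  det-conjugate-transpose n a b a≢b M = begin
    det R n (λ i k → M (τ i) (τ k))   ≈⟨ det-swap-columns n a b a≢b (λ i k → M (τ i) k) ⟩
    - det R n (λ i k → M (τ i) k)     ≈⟨ -‿cong (det-transpose n (λ i k → M (τ i) k)) ⟨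
    - det R n (λ i k → M (τ k) i)     ≈⟨ -‿cong (det-swap-columns n a b a≢b (λ i k → M k i)) ⟩
    - - det R n (λ i k → M k i)       ≈⟨ -‿involutive _ ⟩
    det R n (λ i k → M k i)           ≈⟨ det-transpose n M ⟩
    det R n M                         ∎
    where
    τ : Fin n → Fin n
    τ = transpose a b

  det-add-column-multiple : ∀ n (j k : Fin n) → j ≢ k → ∀ s (M P : Matrix n) →
    (∀ i l → l ≢ j → P i l ≈ M i l) → (∀ i → P i j ≈ M i j + s * M i k) → det R n P ≈ det R n M
  det-add-column-multiple n j k j≢k s M P P≈M P-j = begin
    det R n P                       ≈⟨ det-linear n j 1# s M N P P≈M P≈N P-j′ ⟩
    1# * det R n M + s * det R n N  ≈⟨ +-cong (*-identityˡ _) (trans (*-congˡ N≈0) (zeroʳ s)) ⟩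
    det R n M + 0#                  ≈⟨ +-identityʳ _ ⟩
    det R n M                       ∎
    where
    N : Matrix n
    N i l = if does (l Finₚ.≟ j) then M i k else M i l
    P≈N : ∀ i l → l ≢ j → P i l ≈ N i l
    P≈N i l l≢j rewrite dec-false (l Finₚ.≟ j) l≢j = P≈M i l l≢j
    N-j : ∀ i → N i j ≡ M i k
    N-j i rewrite dec-true (j Finₚ.≟ j) ≡.refl = ≡.refl
    N-k : ∀ i → N i k ≡ M i k
    N-k i rewrite dec-false (k Finₚ.≟ j) (j≢k ∘ ≡.sym) = ≡.refl
    P-j′ : ∀ i → P i j ≈ 1# * M i j + s * N i j
    P-j′ i = trans (P-j i) (+-cong (sym (*-identityˡ _)) (*-congˡ (reflexive (≡.sym (N-j i)))))
    N≈0 : det R n N ≈ 0#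
    N≈0 = det-equal-columns n j k j≢k N (λ i → reflexive (≡.trans (N-j i) (≡.sym (N-k i))))

  det-add-column-multiples : ∀ n {m} (tgt src : Fin m → Fin n) → Injective _≡_ _≡_ tgt →
    (∀ h h′ → tgt h ≢ src h′) → ∀ s (M P : Matrix n) →
    (∀ i l → (∀ h → l ≢ tgt h) → P i l ≈ M i l) →
    (∀ i h → P i (tgt h) ≈ M i (tgt h) + s * M i (src h)) → det R n P ≈ det R n M
  det-add-column-multiples n {zero}  tgt src _ _ s M P P≈M _ = det-cong n (λ i l → P≈M i l (λ ()))
  det-add-column-multiples n {suc m} tgt src tgt-injective disjoint s M P P≈M P-tgt = begin
    det R n P  ≈⟨ det-add-column-multiple n (tgt zero) (src zero) (disjoint zero zero) s Q P P≈Q P-tgt₀ ⟩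
    det R n Q  ≈⟨ det-add-column-multiples n (tgt ∘ suc) (src ∘ suc) (Finₚ.suc-injective ∘ tgt-injective)
                    (λ h h′ → disjoint (suc h) (suc h′)) s M Q Q≈M Q-tgt ⟩
    det R n M  ∎
    where
    Q : Matrix n
    Q i l = if does (l Finₚ.≟ tgt zero) then M i l else P i l
    P≈Q : ∀ i l → l ≢ tgt zero → P i l ≈ Q i l
    P≈Q i l l≢t₀ rewrite dec-false (l Finₚ.≟ tgt zero) l≢t₀ = refl
    P-tgt₀ : ∀ i → P i (tgt zero) ≈ Q i (tgt zero) + s * Q i (src zero)
    P-tgt₀ i rewrite dec-true (tgt zero Finₚ.≟ tgt zero) ≡.refl
                   | dec-false (src zero Finₚ.≟ tgt zero) (disjoint zero zero ∘ ≡.sym) =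
      trans (P-tgt i zero) (+-congˡ (*-congˡ (sym (P≈M i (src zero) (λ h → disjoint h zero ∘ ≡.sym)))))
    Q≈M : ∀ i l → (∀ h → l ≢ tgt (suc h)) → Q i l ≈ M i l
    Q≈M i l l∉ with l Finₚ.≟ tgt zero
    ... | yes _    = refl
    ... | no l≢t₀ = P≈M i l (λ { zero → l≢t₀ ; (suc h) → l∉ h })
    Q-tgt : ∀ i h → Q i (tgt (suc h)) ≈ M i (tgt (suc h)) + s * M i (src (suc h))
    Q-tgt i h rewrite dec-false (tgt (suc h) Finₚ.≟ tgt zero) (λ eq → Finₚ.0≢1+n (≡.sym (tgt-injective eq))) =
      P-tgt i (suc h)

  det-add-row-multiples : ∀ n {m} (tgt src : Fin m → Fin n) → Injective _≡_ _≡_ tgt →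
    (∀ h h′ → tgt h ≢ src h′) → ∀ s (M P : Matrix n) →
    (∀ l k → (∀ h → l ≢ tgt h) → P l k ≈ M l k) →
    (∀ h k → P (tgt h) k ≈ M (tgt h) k + s * M (src h) k) → det R n P ≈ det R n M
  det-add-row-multiples n tgt src tgt-injective disjoint s M P P≈M P-tgt = begin
    det R n P                ≈⟨ det-transpose n P ⟨
    det R n (λ i k → P k i)  ≈⟨ det-add-column-multiples n tgt src tgt-injective disjoint s
                                  (λ i k → M k i) (λ i k → P k i) (λ i l l∉ → P≈M l i l∉) (λ i h → P-tgt h i) ⟩
    det R n (λ i k → M k i)  ≈⟨ det-transpose n M ⟩
    det R n M                ∎

  det-block-lower-triangular : ∀ n m (M : Matrix (n ℕ.+ m)) → (∀ i k → M (i ↑ˡ m) (n ↑ʳ k) ≈ 0#) →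
    det R (n ℕ.+ m) M ≈ det R n (λ i k → M (i ↑ˡ m) (k ↑ˡ m)) * det R m (λ i k → M (n ↑ʳ i) (n ↑ʳ k))
  det-block-lower-triangular zero    m M _       = sym (*-identityˡ _)
  det-block-lower-triangular (suc n) m M upper≈0 = begin
    altSum R (λ l → M zero l * det R (n ℕ.+ m) (minor l M))
      ≈⟨ altSum-↑ˡ (suc n) (λ l → M zero l * det R (n ℕ.+ m) (minor l M)) (λ k → trans (*-congʳ (upper≈0 zero k)) (zeroˡ _)) ⟩
    altSum R (λ j → M zero (j ↑ˡ m) * det R (n ℕ.+ m) (minor (j ↑ˡ m) M))
      ≈⟨ altSum-cong (λ j → trans (*-congˡ {M zero (j ↑ˡ m)} (det-minor j)) (sym (*-assoc _ _ _))) ⟩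
    altSum R (λ j → (X zero j * det R n (minor j X)) * det R m Z)
      ≈⟨ altSum-*ʳ (det R m Z) (λ j → X zero j * det R n (minor j X)) ⟩
    det R (suc n) X * det R m Z ∎
    where
    X : Matrix (suc n)
    X i k = M (i ↑ˡ m) (k ↑ˡ m)
    Z : Matrix m
    Z i k = M (suc n ↑ʳ i) (suc n ↑ʳ k)
    det-minor : ∀ j → det R (n ℕ.+ m) (minor (j ↑ˡ m) M) ≈ det R n (minor j X) * det R m Z
    det-minor j = trans
      (det-block-lower-triangular n m (minor (j ↑ˡ m) M)
        (λ i k → ≡.subst (λ x → M (suc i ↑ˡ m) x ≈ 0#) (≡.sym (punchIn-↑ʳ j k)) (upper≈0 (suc i) k)))
      (*-cong (det-cong n (λ i k → reflexive (≡.cong (M (suc i ↑ˡ m)) (punchIn-↑ˡ j k))))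
              (det-cong m (λ i k → reflexive (≡.cong (M (suc n ↑ʳ i)) (punchIn-↑ʳ j k)))))

  -- Subtract the left half of the columns from the right half, then add the lower half of the
  -- rows to the upper half: the result is block lower triangular with diagonal A + B, A − B.
  det-block-symmetric : ∀ n (M : Matrix (n ℕ.+ n)) → BlockSymmetric n M →
    det R (n ℕ.+ n) M ≈ det R n (λ i k → upperLeft M i k + upperRight M i k)
                      * det R n (λ i k → upperLeft M i k - upperRight M i k)
  det-block-symmetric n M sym-M = begin
    det R (n ℕ.+ n) M
      ≈⟨ det-add-column-multiples (n ℕ.+ n) (n ↑ʳ_) (_↑ˡ n) (Finₚ.↑ʳ-injective n _ _) (λ h h′ → ↑ˡ≢↑ʳ h′ h ∘ ≡.sym)
           (- 1#) M M₁ M₁-left M₁-right ⟨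
    det R (n ℕ.+ n) M₁
      ≈⟨ det-add-row-multiples (n ℕ.+ n) (_↑ˡ n) (n ↑ʳ_) (Finₚ.↑ˡ-injective n _ _) ↑ˡ≢↑ʳ
           1# M₁ M₂ M₂-bottom M₂-top ⟨
    det R (n ℕ.+ n) M₂
      ≈⟨ det-block-lower-triangular n n M₂ M₂-upper≈0 ⟩
    det R n (upperLeft M₂) * det R n (lowerRight M₂)
      ≈⟨ *-cong (det-cong n M₂-upper-left) (det-cong n M₂-lower-right) ⟩
    det R n (λ i k → A i k + B i k) * det R n (λ i k → A i k - B i k) ∎
    where
    A B : Matrix n
    A = upperLeft M
    B = upperRight M
    M₁ M₂ : Matrix (n ℕ.+ n)
    M₁ i = (λ h → M i (h ↑ˡ n)) ++ (λ h → M i (n ↑ʳ h) - M i (h ↑ˡ n))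
    M₂ = (λ h k → M₁ (h ↑ˡ n) k + M₁ (n ↑ʳ h) k) ++ (λ h → M₁ (n ↑ʳ h))
    M₁-↑ˡ : ∀ i h → M₁ i (h ↑ˡ n) ≡ M i (h ↑ˡ n)
    M₁-↑ˡ i = lookup-++ˡ (λ h → M i (h ↑ˡ n)) (λ h → M i (n ↑ʳ h) - M i (h ↑ˡ n))
    M₁-↑ʳ : ∀ i h → M₁ i (n ↑ʳ h) ≡ M i (n ↑ʳ h) - M i (h ↑ˡ n)
    M₁-↑ʳ i = lookup-++ʳ (λ h → M i (h ↑ˡ n)) (λ h → M i (n ↑ʳ h) - M i (h ↑ˡ n))
    M₂-↑ˡ : ∀ h k → M₂ (h ↑ˡ n) k ≡ M₁ (h ↑ˡ n) k + M₁ (n ↑ʳ h) k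
    M₂-↑ˡ h = ≡.cong-app (lookup-++ˡ (λ h k → M₁ (h ↑ˡ n) k + M₁ (n ↑ʳ h) k) (λ h → M₁ (n ↑ʳ h)) h)
    M₂-↑ʳ : ∀ h k → M₂ (n ↑ʳ h) k ≡ M₁ (n ↑ʳ h) k
    M₂-↑ʳ h = ≡.cong-app (lookup-++ʳ (λ h k → M₁ (h ↑ˡ n) k + M₁ (n ↑ʳ h) k) (λ h → M₁ (n ↑ʳ h)) h)
    M₁-left : ∀ i l → (∀ h → l ≢ n ↑ʳ h) → M₁ i l ≈ M i l
    M₁-left i l l∉ with ↑ˡ-or-↑ʳ n l
    ... | inj₁ (h , ≡.refl) = reflexive (M₁-↑ˡ i h)
    ... | inj₂ (h , ≡.refl) = ⊥-elim (l∉ h ≡.refl)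
    M₁-right : ∀ i h → M₁ i (n ↑ʳ h) ≈ M i (n ↑ʳ h) + - 1# * M i (h ↑ˡ n)
    M₁-right i h = trans (reflexive (M₁-↑ʳ i h)) (+-congˡ (sym (-1*x≈-x _)))
    M₂-bottom : ∀ l k → (∀ h → l ≢ h ↑ˡ n) → M₂ l k ≈ M₁ l k
    M₂-bottom l k l∉ with ↑ˡ-or-↑ʳ n l
    ... | inj₁ (h , ≡.refl) = ⊥-elim (l∉ h ≡.refl)
    ... | inj₂ (h , ≡.refl) = reflexive (M₂-↑ʳ h k)
    M₂-top : ∀ h k → M₂ (h ↑ˡ n) k ≈ M₁ (h ↑ˡ n) k + 1# * M₁ (n ↑ʳ h) k
    M₂-top h k = trans (reflexive (M₂-↑ˡ h k)) (+-congˡ (sym (*-identityˡ _)))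
    M₂-upper-left : ∀ i k → M₂ (i ↑ˡ n) (k ↑ˡ n) ≈ A i k + B i k
    M₂-upper-left i k = reflexive (≡.trans (M₂-↑ˡ i (k ↑ˡ n))
      (≡.cong₂ _+_ (M₁-↑ˡ (i ↑ˡ n) k) (≡.trans (M₁-↑ˡ (n ↑ʳ i) k) (proj₁ (sym-M i k)))))
    M₂-upper≈0 : ∀ i k → M₂ (i ↑ˡ n) (n ↑ʳ k) ≈ 0#
    M₂-upper≈0 i k = begin
      M₂ (i ↑ˡ n) (n ↑ʳ k)
        ≡⟨ ≡.trans (M₂-↑ˡ i (n ↑ʳ k)) (≡.cong₂ _+_ (M₁-↑ʳ (i ↑ˡ n) k)
             (≡.trans (M₁-↑ʳ (n ↑ʳ i) k) (≡.cong₂ _-_ (proj₂ (sym-M i k)) (proj₁ (sym-M i k))))) ⟩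
      (B i k - A i k) + (A i k - B i k)
        ≈⟨ solve 2 (λ a b → (b :- a) :+ (a :- b) := con (+ 0)) refl (A i k) (B i k) ⟩
      0# ∎
    M₂-lower-right : ∀ i k → M₂ (n ↑ʳ i) (n ↑ʳ k) ≈ A i k - B i k
    M₂-lower-right i k = reflexive (≡.trans (M₂-↑ʳ i (n ↑ʳ k))
      (≡.trans (M₁-↑ʳ (n ↑ʳ i) k) (≡.cong₂ _-_ (proj₂ (sym-M i k)) (proj₁ (sym-M i k)))))

  -- det with its definition hidden: when two concrete 8 × 8 or 16 × 16 determinants agree only up
  -- to unfolding, the type checker compares them by expanding both completely.
  opaque
    Det : ∀ n → Matrix n → Carrier
    Det = det R

  opaque
    unfolding Det
    det≈Det : ∀ n M → det R n M ≈ Det n M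
    det≈Det n M = refl

  Det-cong : ∀ n {M N : Matrix n} → (∀ i k → M i k ≈ N i k) → Det n M ≈ Det n N
  Det-cong n {M} {N} M≈N = trans (sym (det≈Det n M)) (trans (det-cong n M≈N) (det≈Det n N))

  Det-conjugate-transpose : ∀ n (a b : Fin n) → a ≢ b → ∀ M → Det n (conjugate (transpose a b) M) ≈ Det n M
  Det-conjugate-transpose n a b a≢b M =
    trans (sym (det≈Det n _)) (trans (det-conjugate-transpose n a b a≢b M) (det≈Det n M))

  Det-block-symmetric : ∀ n (M : Matrix (n ℕ.+ n)) → BlockSymmetric n M →
    Det (n ℕ.+ n) M ≈ Det n (λ i k → upperLeft M i k + upperRight M i k)
                    * Det n (λ i k → upperLeft M i k - upperRight M i k)
  Det-block-symmetric n M sym-M =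
    trans (sym (det≈Det _ M)) (trans (det-block-symmetric n M sym-M) (*-cong (det≈Det n _) (det≈Det n _)))

module SymbolicDeterminant {c ℓ : Level} (R : CommutativeRing c ℓ) where
  open CommutativeRing R hiding (zero)
  open IntegerCoefficients R using (Polynomial; ⟦_⟧; con; _:-_; _:*_)
  open Determinant R using (altSum-cong)

  altSumˢ : ∀ {v m} → (Fin m → Polynomial v) → Polynomial v
  altSumˢ {m = zero}  f = con (+ 0)
  altSumˢ {m = suc m} f = f zero :- altSumˢ (λ j → f (suc j))

  detˢ : ∀ {v} n → (Fin n → Fin n → Polynomial v) → Polynomial v
  detˢ zero    M = con (+ 1)
  detˢ (suc n) M = altSumˢ (λ j → M zero j :* detˢ n (λ i k → M (suc i) (punchIn j k)))

  ⟦altSumˢ⟧ : ∀ {v m} (f : Fin m → Polynomial v) ρ → ⟦ altSumˢ f ⟧ ρ ≈ altSum R (λ j → ⟦ f j ⟧ ρ)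
  ⟦altSumˢ⟧ {m = zero}  f ρ = refl
  ⟦altSumˢ⟧ {m = suc m} f ρ = +-congˡ (-‿cong (⟦altSumˢ⟧ (λ j → f (suc j)) ρ))

  ⟦detˢ⟧ : ∀ {v} n (M : Fin n → Fin n → Polynomial v) ρ → ⟦ detˢ n M ⟧ ρ ≈ det R n (λ i k → ⟦ M i k ⟧ ρ)
  ⟦detˢ⟧ zero    M ρ = +-identityʳ 1#
  ⟦detˢ⟧ (suc n) M ρ = trans (⟦altSumˢ⟧ (λ j → M zero j :* detˢ n (λ i k → M (suc i) (punchIn j k))) ρ)
    (altSum-cong (λ j → *-congˡ {⟦ M zero j ⟧ ρ} (⟦detˢ⟧ n (λ i k → M (suc i) (punchIn j k)) ρ)))

ixG : Fin 16 → Fin 16 → Fin 16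
ixG g h = idxG (mulG (elemG g) (invG (elemG h)))

ixC : Fin 8 → Fin 8 → Fin 8
ixC g h = idxC (mulC (elemC g) (invC (elemC h)))

-- The halves of Fin (8 + 8) are the cosets s ∈ {0, 1} and s ∈ {2, 3} of the central subgroup ⟨g₁²⟩,
-- and multiplying by g₁² exchanges them.
ixG-blockSymmetric : BlockSymmetric 8 ixG
ixG-blockSymmetric = from-yes (blockSymmetric? Finₚ._≟_ 8 ixG)

_≟²_ : DecidableEquality (Fin 16 × Fin 16)
_≟²_ = Productₚ.≡-dec Finₚ._≟_ Finₚ._≟_

-- G/⟨g₁²⟩ ≅ C₄ × C₂ via g₁^s g₂^t ↦ (t, s mod 2); the element with index c lifts to c ↑ˡ 8 and
-- 8 ↑ʳ c.
IsLiftPair : Fin 16 × Fin 16 → Fin 8 → Set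
IsLiftPair p c = p ≡ (c ↑ˡ 8 , 8 ↑ʳ c) ⊎ p ≡ (8 ↑ʳ c , c ↑ˡ 8)

ixG-lifts-ixC : ∀ i k → IsLiftPair (upperLeft ixG i k , upperRight ixG i k) (ixC i k)
ixG-lifts-ixC = from-yes (Finₚ.all? λ i → Finₚ.all? λ k →
  ((upperLeft ixG i k , upperRight ixG i k) ≟² (ixC i k ↑ˡ 8 , 8 ↑ʳ ixC i k)) ⊎-dec
  ((upperLeft ixG i k , upperRight ixG i k) ≟² (8 ↑ʳ ixC i k , ixC i k ↑ˡ 8)))

-- π lists g₁^s g₂^t (s ∈ {0, 1}) with t ∈ {0, 1} first and t ∈ {2, 3} second: the cosets of the
-- central subgroup ⟨g₂²⟩.
π : Fin 8 → Fin 8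
π = transpose (# 2) (# 4) ∘ transpose (# 3) (# 5)

ixGπ : Fin 8 → Fin 8 → Fin 16 × Fin 16
ixGπ = conjugate π (λ i k → upperLeft ixG i k , upperRight ixG i k)

ixGπ-blockSymmetric : BlockSymmetric 4 ixGπ
ixGπ-blockSymmetric = from-yes (blockSymmetric? _≟²_ 4 ixGπ)

module _ {c ℓ : Level} (R : CommutativeRing c ℓ) (z : Fin 16 → CommutativeRing.Carrier R) where
  open CommutativeRing R hiding (zero)
  open IntegerCoefficients R using (Polynomial; var; ⟦_⟧; prove; solve; _:=_; _:+_; _:-_; _:*_)
  open Determinant R
  open SymbolicDeterminant R
  open import Relation.Binary.Reasoning.Setoid setoid

  G : Matrix 16
  G g h = z (ixG g h)

  sumBlock differenceBlock : Matrix 8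
  sumBlock        i k = upperLeft G i k + upperRight G i k
  differenceBlock i k = upperLeft G i k - upperRight G i k

  Gπ : Matrix 8
  Gπ = conjugate π differenceBlock

  G-blockSymmetric : BlockSymmetric 8 G
  G-blockSymmetric = BlockSymmetric-map 8 z {ixG} ixG-blockSymmetric

  Gπ-blockSymmetric : BlockSymmetric 4 Gπ
  Gπ-blockSymmetric = BlockSymmetric-map 4 (λ p → z (proj₁ p) - z (proj₂ p)) {ixGπ} ixGπ-blockSymmetric

  ρ : Vec Carrier 16
  ρ = tabulate z

  Gπˢ : Fin 8 → Fin 8 → Polynomial 16
  Gπˢ = conjugate π (λ i k → var (upperLeft ixG i k) :- var (upperRight ixG i k))

  ⟦Gπˢ⟧ : ∀ i k → ⟦ Gπˢ i k ⟧ ρ ≡ Gπ i k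
  ⟦Gπˢ⟧ i k = ≡.cong₂ _-_ (lookup∘tabulate z _) (lookup∘tabulate z _)

  w : Fin 8 → Carrier
  w j = z (j ↑ˡ 8) - z (8 ↑ʳ j)

  wˢ : Fin 8 → Polynomial 16
  wˢ j = var (j ↑ˡ 8) :- var (8 ↑ʳ j)

  F₀ F₁ : Carrier
  F₀ = f0 R (w (# 0) - w (# 2)) (w (# 4) - w (# 6)) (w (# 1) - w (# 3)) (w (# 5) - w (# 7))
  F₁ = f1 R (w (# 0) + w (# 2)) (w (# 4) + w (# 6)) (w (# 1) + w (# 3)) (w (# 5) + w (# 7))

  f0ˢ f1ˢ : Polynomial 16 → Polynomial 16 → Polynomial 16 → Polynomial 16 → Polynomial 16
  f0ˢ x y u v = x :* x :+ y :* y :+ u :* u :+ v :* v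
  f1ˢ x y u v = x :* x :+ y :* y :- u :* u :- v :* v

  F₀ˢ F₁ˢ : Polynomial 16
  F₀ˢ = f0ˢ (wˢ (# 0) :- wˢ (# 2)) (wˢ (# 4) :- wˢ (# 6)) (wˢ (# 1) :- wˢ (# 3)) (wˢ (# 5) :- wˢ (# 7))
  F₁ˢ = f1ˢ (wˢ (# 0) :+ wˢ (# 2)) (wˢ (# 4) :+ wˢ (# 6)) (wˢ (# 1) :+ wˢ (# 3)) (wˢ (# 5) :+ wˢ (# 7))

  DG≈Det-G : DG R z ≈ Det 16 G
  DG≈Det-G = trans (det≈Det 16 (λ g h → z (idxG (mulG (elemG g) (invG (elemG h)))))) (Det-cong 16 (λ _ _ → refl))

  -- The ring operations are written as projections so that the matrix is syntactically the body of D42.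
  Det-sumBlock≈D42 : Det 8 sumBlock ≈ D42 R (λ j → CommutativeRing._+_ R (z (j ↑ˡ 8)) (z (8 ↑ʳ j)))
  Det-sumBlock≈D42 =
    trans (Det-cong 8 {N = λ g h → CommutativeRing._+_ R (z (idxC (mulC (elemC g) (invC (elemC h))) ↑ˡ 8))
                                                         (z (8 ↑ʳ idxC (mulC (elemC g) (invC (elemC h)))))}
                      (λ i k → lift-sum (ixG-lifts-ixC i k)))
          (sym (det≈Det 8 _))
    where
    lift-sum : ∀ {a b c} → IsLiftPair (a , b) c → z a + z b ≈ z (c ↑ˡ 8) + z (8 ↑ʳ c)
    lift-sum (inj₁ ≡.refl) = refl
    lift-sum (inj₂ ≡.refl) = +-comm _ _

  Det-Gπ-sum : Det 4 (λ i k → upperLeft Gπ i k + upperRight Gπ i k) ≈ F₁ * F₁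
  Det-Gπ-sum = begin
    Det 4 (λ i k → upperLeft Gπ i k + upperRight Gπ i k)
      ≈⟨ Det-cong 4 (λ i k → reflexive (≡.sym
           (≡.cong₂ _+_ (⟦Gπˢ⟧ (i ↑ˡ 4) (k ↑ˡ 4)) (⟦Gπˢ⟧ (i ↑ˡ 4) (4 ↑ʳ k))))) ⟩
    Det 4 (λ i k → ⟦ Mˢ i k ⟧ ρ)  ≈⟨ trans (⟦detˢ⟧ 4 Mˢ ρ) (det≈Det 4 _) ⟨
    ⟦ detˢ 4 Mˢ ⟧ ρ               ≈⟨ prove ρ (detˢ 4 Mˢ) (F₁ˢ :* F₁ˢ) refl ⟩
    F₁ * F₁                       ∎
    where
    Mˢ : Fin 4 → Fin 4 → Polynomial 16
    Mˢ i k = upperLeft Gπˢ i k :+ upperRight Gπˢ i k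

  Det-Gπ-difference : Det 4 (λ i k → upperLeft Gπ i k - upperRight Gπ i k) ≈ F₀ * F₀
  Det-Gπ-difference = begin
    Det 4 (λ i k → upperLeft Gπ i k - upperRight Gπ i k)
      ≈⟨ Det-cong 4 (λ i k → reflexive (≡.sym
           (≡.cong₂ _-_ (⟦Gπˢ⟧ (i ↑ˡ 4) (k ↑ˡ 4)) (⟦Gπˢ⟧ (i ↑ˡ 4) (4 ↑ʳ k))))) ⟩
    Det 4 (λ i k → ⟦ Mˢ i k ⟧ ρ)  ≈⟨ trans (⟦detˢ⟧ 4 Mˢ ρ) (det≈Det 4 _) ⟨
    ⟦ detˢ 4 Mˢ ⟧ ρ               ≈⟨ prove ρ (detˢ 4 Mˢ) (F₀ˢ :* F₀ˢ) refl ⟩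
    F₀ * F₀                       ∎
    where
    Mˢ : Fin 4 → Fin 4 → Polynomial 16
    Mˢ i k = upperLeft Gπˢ i k :- upperRight Gπˢ i k

  Det-differenceBlock : Det 8 differenceBlock ≈ F R w * F R w
  Det-differenceBlock = begin
    Det 8 differenceBlock
      ≈⟨ Det-conjugate-transpose 8 (# 2) (# 4) (λ ()) differenceBlock ⟨
    Det 8 (conjugate (transpose (# 2) (# 4)) differenceBlock)
      ≈⟨ Det-conjugate-transpose 8 (# 3) (# 5) (λ ()) (conjugate (transpose (# 2) (# 4)) differenceBlock) ⟨
    Det 8 (conjugate (transpose (# 3) (# 5)) (conjugate (transpose (# 2) (# 4)) differenceBlock))
      ≈⟨ Det-cong 8 (λ _ _ → refl) ⟩
    Det 8 Gπ
      ≈⟨ Det-block-symmetric 4 Gπ Gπ-blockSymmetric ⟩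
    Det 4 (λ i k → upperLeft Gπ i k + upperRight Gπ i k) * Det 4 (λ i k → upperLeft Gπ i k - upperRight Gπ i k)
      ≈⟨ *-cong Det-Gπ-sum Det-Gπ-difference ⟩
    (F₁ * F₁) * (F₀ * F₀)
      ≈⟨ solve 2 (λ a b → (b :* b) :* (a :* a) := (a :* b) :* (a :* b)) refl F₀ F₁ ⟩
    F R w * F R w ∎

lemma2p2 : ∀ {c ℓ : Level} (R : CommutativeRing c ℓ) (z : Fin 16 → CommutativeRing.Carrier R) →
    CommutativeRing._≈_ R (DG R z)
      (CommutativeRing._*_ R
        (D42 R (λ j → CommutativeRing._+_ R (z (j ↑ˡ 8)) (z (8 ↑ʳ j))))
        (CommutativeRing._*_ R
          (F R (λ j → CommutativeRing._-_ R (z (j ↑ˡ 8)) (z (8 ↑ʳ j))))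
          (F R (λ j → CommutativeRing._-_ R (z (j ↑ˡ 8)) (z (8 ↑ʳ j))))))
lemma2p2 R z = begin
  DG R z
    ≈⟨ DG≈Det-G R z ⟩
  Det 16 (G R z)
    ≈⟨ Det-block-symmetric 8 (G R z) (G-blockSymmetric R z) ⟩
  Det 8 (sumBlock R z) * Det 8 (differenceBlock R z)
    ≈⟨ *-cong (Det-sumBlock≈D42 R z) (Det-differenceBlock R z) ⟩
  D42 R (λ j → CommutativeRing._+_ R (z (j ↑ˡ 8)) (z (8 ↑ʳ j)))
    * (F R (λ j → CommutativeRing._-_ R (z (j ↑ˡ 8)) (z (8 ↑ʳ j)))
       * F R (λ j → CommutativeRing._-_ R (z (j ↑ˡ 8)) (z (8 ↑ʳ j)))) ∎
  where
  open CommutativeRing R using (_*_; *-cong; setoid)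
  open Determinant R using (Det; Det-block-symmetric)
  open import Relation.Binary.Reasoning.Setoid setoid
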